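{- Let $p>2$ be a prime, $k\ge0$ an integer, and let $\mathbf{x}$ be a $p$-adic unit whose corresponding Witt vector $(x_0,x_1,x_2,\dots)$ (entries in $\mathbb{Z}/p\mathbb{Z}$) satisfies $x_0\not\equiv0$ and $x_i\equiv 0\pmod p$ for $i=1,\dots,k$. Then ${\sf q}_1(\mathbf{x})$ is divisible by $p^k$ and $$x_{k+1}\equiv -\frac{1}{p^k}\,\mathbf{x}\,{\sf q}_1(\mathbf{x})\pmod p.$$ Moreover, for $k\ge1$, $\mathbf{x}$ has a $p^k$-th root $\mathbf{x}^{1/p^k}$ in the $p$-adic integers, its Witt vector is congruent to $(x_0,x_{k+1}]$ modulo $p^2$, and $${\sf q}_1\big(\mathbf{x}^{1/p^k}\big)\equiv \frac{1}{p^k}\,{\sf q}_1(\mathbf{x})\pmod p.$$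
   Context: The ring of $p$-adic integers is identified with the ring $\mathfrak{W}(\mathbb{Z}_p)$ of Witt vectors over $\mathbb{Z}/p\mathbb{Z}$, where $(x_0,x_1,\dots)$ corresponds to $\sum_i p^i[x_i]$ with $[\cdot]$ the Teichmüller lift. $(x_0,x_1]$ denotes the truncated Witt vector, i.e. the class modulo $p^2$. For a $p$-adic unit $\mathbf{x}$, the Fermat quotient is ${\sf q}_1(\mathbf{x})=\frac{\mathbf{x}^{p-1}-1}{p}$. -}

module Defs where

open import Data.Nat as ℕ using (ℕ; zero; suc)
open import Data.Integer using (ℤ; +_; _+_; _-_; _*_; _^_; -_)
open import Data.Integer.Divisibility using (_∣_)
open import Data.Integer.DivMod using (_/ℕ_)
open import Data.Fin using (Fin; toℕ)

-- A p-adic integer is represented by a sequence of integer approximants: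
-- x n is an approximation of x modulo p ^ n.
Seq : Set
Seq = ℕ → ℤ

infix 4 _≋_[mod_]
_≋_[mod_] : ℤ → ℤ → ℕ → Set
a ≋ b [mod m ] = (+ m) ∣ (a - b)

IsPadic : ℕ → Seq → Set
IsPadic p x = ∀ n → x (suc n) ≋ x n [mod p ℕ.^ n ]

_≈[_]_ : Seq → ℕ → Seq → Set
x ≈[ p ] y = ∀ n → x n ≋ y n [mod p ℕ.^ n ]

_⊕_ _⊗_ : Seq → Seq → Seq
(x ⊕ y) n = x n + y n
(x ⊗ y) n = x n * y n

⊖_ : Seq → Seq
(⊖ x) n = - (x n)

const : ℤ → Seq
const c n = c

_^ₚ_ : Seq → ℕ → Seq
(x ^ₚ m) n = x n ^ m

-- exact division by p (used only on multiples of p)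
divBy : ℕ → ℤ → ℤ
divBy zero    a = a
divBy (suc m) a = a /ℕ suc m

-- Teichmüller lift [a] of a residue a : the p-adic integer lim a^(p^n)
teich : (p : ℕ) → Fin p → Seq
teich p a n = (+ toℕ a) ^ (p ℕ.^ n)

sumBelow : ℕ → (ℕ → ℤ) → ℤ
sumBelow zero    f = + 0
sumBelow (suc n) f = sumBelow n f + f n

-- w : ℕ → Fin p is the Witt vector of x, i.e. x = Σ_i p^i [w i]
IsWitt : (p : ℕ) → Seq → (ℕ → Fin p) → Set
IsWitt p x w = ∀ n → x n ≋ sumBelow n (λ i → (+ (p ℕ.^ i)) * teich p (w i) n) [mod p ℕ.^ n ]

-- Fermat quotient q₁(x) = (x^(p-1) - 1)/p ; level n uses x modulo p^(n+1)
q₁ : ℕ → Seq → Seq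
q₁ p x n = divBy p (x (suc n) ^ (p ℕ.∸ 1) - + 1)

-- Write a = x₀ and b = x_{k+1}. As x₁, …, x_k vanish, x ≡ [a] + p^(k+1)·[b] (mod p^(k+2)).
-- Since [a] is a (p−1)-st root of unity, x^(p−1) ≡ 1 (mod p^(k+1)), i.e. p^k divides q₁(x), and
-- the digit b is read off from p·x·q₁(x) = x^p − x together with x^p ≡ [a]^p = [a] (mod p^(k+2)).
-- Everything else follows from one consequence of the binomial theorem for odd p: for a unit s and m ≥ 1,
-- (s + p^m·t)^(p^k) ≡ s^(p^k) + p^(m+k)·t (mod p^(m+k+1)). It builds the p^k-th root r of x by
-- successive approximation, and applied to r = [a] + p·d and to r^(p−1) = 1 + p·q₁(r) it yields
-- the digits of r and q₁(r) ≡ q₁(x)/p^k (mod p).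

module Submission where

open import Defs
open import Data.Nat using (ℕ; suc; _<_; _≤_; _^_)
open import Data.Nat.Primality using (Prime)
open import Data.Fin using (Fin; toℕ)
open import Data.Integer using (+_; _+_; _*_; _-_; -_)
open import Data.Product using (Σ; _×_)
open import Relation.Binary.PropositionalEquality using (_≡_; _≢_)

open import Data.Nat as ℕ using (zero; z≤n; s≤s; NonZero)
import Data.Nat.Properties as ℕ
import Data.Nat.Divisibility as ℕ
import Data.Nat.DivMod as ℕ
open import Data.Integer as ℤ using (ℤ; 0ℤ; 1ℤ) renaming (_^_ to _^ᶻ_)
import Data.Integer.Properties as ℤ
open import Data.Integer.Divisibility.Signed
  using (_∣_; divides; ∣ᵤ⇒∣; ∣⇒∣ᵤ; ∣-refl; ∣-trans; ∣m∣n⇒∣m+n; ∣m⇒∣-m; ∣m⇒∣m*n; ∣n⇒∣m*n; *-cancelˡ-∣)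
open import Data.Integer.Tactic.RingSolver using (solve-∀)
open import Data.Product using (_,_; proj₁; proj₂; ∃-syntax)
open import Data.Nat.Primality using (¬prime[1]; prime⇒nonZero; prime⇒nonTrivial; euclidsLemma)
open import Data.Nat.Combinatorics using (_C_; nC1≡n; nCn≡1; k![n∸k]!∣n!)
open import Data.Nat.Combinatorics.Specification using (nCk≡n!/k![n-k]!)
import Algebra.Properties.CommutativeSemiring.Binomial ℤ.+-*-commutativeSemiring as Binomial
open import Algebra.Properties.Semiring.Sum ℤ.+-*-semiring using (sum; sum-syntax; sum-init-last; *-distribˡ-sum; sum-cong-≗)
open import Algebra.Properties.Semiring.Exp ℤ.+-*-semiring using () renaming (_^_ to _^ˢ_)
open import Algebra.Properties.Semiring.Mult ℤ.+-*-semiring using () renaming (_×_ to _×ˢ_)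
open import Data.Fin using (zero; suc; inject₁; fromℕ)
import Data.Fin.Properties as Fin
open import Data.Sum using (inj₁; inj₂)
open import Data.Empty using (⊥-elim)
open import Relation.Nullary using (¬_)
open import Relation.Binary using (IsEquivalence; Setoid)
import Relation.Binary.Reasoning.Setoid
open import Relation.Binary.PropositionalEquality
  using (refl; sym; trans; cong; cong₂; subst; subst₂; module ≡-Reasoning)

-- Congruences

-- A record wrapper around signed divisibility, so that both sides can be
-- inferred from the type of a congruence.
infix 4 _≡_[mod_]
record _≡_[mod_] (a b : ℤ) (m : ℕ) : Set where
  constructor mod-intro
  field mod-divides : + m ∣ a - b

open _≡_[mod_] public

≋⇒≡-mod : ∀ {a b m} → a ≋ b [mod m ] → a ≡ b [mod m ]
≋⇒≡-mod h = mod-intro (∣ᵤ⇒∣ h)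

≡-mod⇒≋ : ∀ {a b m} → a ≡ b [mod m ] → a ≋ b [mod m ]
≡-mod⇒≋ h = ∣⇒∣ᵤ (mod-divides h)

module _ {m : ℕ} where

  private
    d∣-resp : ∀ {z z′} → z ≡ z′ → + m ∣ z → + m ∣ z′
    d∣-resp refl h = h

  ≡⇒≡-mod : ∀ {a b} → a ≡ b → a ≡ b [mod m ]
  ≡⇒≡-mod {a} refl = mod-intro (divides 0ℤ (trans (ℤ.+-inverseʳ a) (sym (ℤ.*-zeroˡ (+ m)))))

  ≡-mod-refl : ∀ {a} → a ≡ a [mod m ]
  ≡-mod-refl = ≡⇒≡-mod refl

  ≡-mod-sym : ∀ {a b} → a ≡ b [mod m ] → b ≡ a [mod m ]
  ≡-mod-sym {a} {b} (mod-intro h) = mod-intro (d∣-resp (neg-sub a b) (∣m⇒∣-m h))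
    where
    neg-sub : ∀ a b → - (a - b) ≡ b - a
    neg-sub = solve-∀

  ≡-mod-trans : ∀ {a b c} → a ≡ b [mod m ] → b ≡ c [mod m ] → a ≡ c [mod m ]
  ≡-mod-trans {a} {b} {c} (mod-intro h) (mod-intro h′) = mod-intro (d∣-resp (sub-sub a b c) (∣m∣n⇒∣m+n h h′))
    where
    sub-sub : ∀ a b c → (a - b) + (b - c) ≡ a - c
    sub-sub = solve-∀

  ≡-mod-isEquivalence : IsEquivalence _≡_[mod m ]
  ≡-mod-isEquivalence = record { refl = ≡-mod-refl ; sym = ≡-mod-sym ; trans = ≡-mod-trans }

  ≡-mod-setoid : Setoid _ _
  ≡-mod-setoid = record { isEquivalence = ≡-mod-isEquivalence }

  +-cong-mod : ∀ {a b c d} → a ≡ b [mod m ] → c ≡ d [mod m ] → a + c ≡ b + d [mod m ]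
  +-cong-mod {a} {b} {c} {d} (mod-intro h) (mod-intro h′) = mod-intro (d∣-resp (sub-+ a b c d) (∣m∣n⇒∣m+n h h′))
    where
    sub-+ : ∀ a b c d → (a - b) + (c - d) ≡ (a + c) - (b + d)
    sub-+ = solve-∀

  -‿cong-mod : ∀ {a b} → a ≡ b [mod m ] → - a ≡ - b [mod m ]
  -‿cong-mod {a} {b} (mod-intro h) = mod-intro (d∣-resp (neg-sub a b) (∣m⇒∣-m h))
    where
    neg-sub : ∀ a b → - (a - b) ≡ (- a) - (- b)
    neg-sub = solve-∀

  *-cong-mod : ∀ {a b c d} → a ≡ b [mod m ] → c ≡ d [mod m ] → a * c ≡ b * d [mod m ]
  *-cong-mod {a} {b} {c} {d} (mod-intro h) (mod-intro h′) =
    mod-intro (d∣-resp (sub-* a b c d) (∣m∣n⇒∣m+n (∣m⇒∣m*n c h) (∣n⇒∣m*n b h′)))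
    where
    sub-* : ∀ a b c d → (a - b) * c + b * (c - d) ≡ a * c - b * d
    sub-* = solve-∀

  ^-cong-mod : ∀ {a b} n → a ≡ b [mod m ] → a ^ᶻ n ≡ b ^ᶻ n [mod m ]
  ^-cong-mod zero    h = ≡-mod-refl
  ^-cong-mod (suc n) h = *-cong-mod h (^-cong-mod n h)

  +-congˡ-mod : ∀ c {a b} → a ≡ b [mod m ] → c + a ≡ c + b [mod m ]
  +-congˡ-mod c = +-cong-mod (≡-mod-refl {c})

  +-congʳ-mod : ∀ c {a b} → a ≡ b [mod m ] → a + c ≡ b + c [mod m ]
  +-congʳ-mod c h = +-cong-mod h (≡-mod-refl {c})

  multiple-mod : ∀ a c → a + + m * c ≡ a [mod m ]
  multiple-mod a c = mod-intro (d∣-resp (sym (add-sub a (+ m * c))) (∣m⇒∣m*n c ∣-refl))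
    where
    add-sub : ∀ a z → (a + z) - a ≡ z
    add-sub = solve-∀

  ≡-mod⇒multiple : ∀ {a b} → a ≡ b [mod m ] → ∃[ c ] a ≡ b + + m * c
  ≡-mod⇒multiple {a} {b} (mod-intro (divides c eq)) = c , (begin
      a               ≡⟨ split a b ⟩
      b + (a - b)     ≡⟨ cong (λ z → b + z) eq ⟩
      b + c * + m     ≡⟨ cong (λ z → b + z) (ℤ.*-comm c (+ m)) ⟩
      b + + m * c     ∎)
    where
    open ≡-Reasoning
    split : ∀ a b → a ≡ b + (a - b)
    split = solve-∀

  +-cancelˡ-mod : ∀ {a b c} → c + a ≡ c + b [mod m ] → a ≡ b [mod m ]
  +-cancelˡ-mod {a} {b} {c} (mod-intro h) = mod-intro (d∣-resp (sub-cancel c a b) h)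
    where
    sub-cancel : ∀ c a b → (c + a) - (c + b) ≡ a - b
    sub-cancel = solve-∀

  mod-weaken : ∀ {a b n} → m ℕ.∣ n → a ≡ b [mod n ] → a ≡ b [mod m ]
  mod-weaken m∣n (mod-intro h) = mod-intro (∣-trans (∣ᵤ⇒∣ m∣n) h)

module ModReasoning (m : ℕ) = Relation.Binary.Reasoning.Setoid (≡-mod-setoid {m})


≡0-mod⇒∣ : ∀ {a m} → a ≡ 0ℤ [mod m ] → + m ∣ a
≡0-mod⇒∣ {a} (mod-intro h) = subst (_ ∣_) (ℤ.+-identityʳ a) h

mod-1 : ∀ {a b} → a ≡ b [mod 1 ]
mod-1 {a} {b} = mod-intro (divides (a - b) (sym (ℤ.*-identityʳ (a - b))))

mod-scale : ∀ {a b m} n → a ≡ b [mod m ] → + n * a ≡ + n * b [mod n ℕ.* m ]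
mod-scale {a} {b} {m} n (mod-intro (divides c eq)) = mod-intro (divides c (begin
    + n * a - + n * b     ≡⟨ *-sub (+ n) a b ⟩
    + n * (a - b)         ≡⟨ cong (+ n *_) eq ⟩
    + n * (c * + m)       ≡⟨ *-swap (+ n) c (+ m) ⟩
    c * (+ n * + m)       ≡⟨ cong (c *_) (ℤ.pos-* n m) ⟨
    c * + (n ℕ.* m)       ∎))
  where
  open ≡-Reasoning
  *-sub : ∀ n a b → n * a - n * b ≡ n * (a - b)
  *-sub = solve-∀
  *-swap : ∀ n c m → n * (c * m) ≡ c * (n * m)
  *-swap = solve-∀

mod-cancel : ∀ {a b m} n .{{_ : NonZero n}} → + n * a ≡ + n * b [mod n ℕ.* m ] → a ≡ b [mod m ]
mod-cancel {a} {b} {m} n (mod-intro h) = mod-intro (*-cancelˡ-∣ (+ n) (subst₂ _∣_ (ℤ.pos-* n m) (*-sub (+ n) a b) h))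
  where
  *-sub : ∀ n a b → n * a - n * b ≡ n * (a - b)
  *-sub = solve-∀

divBy-exact : ∀ m {c} → + m ∣ c → + m * divBy m c ≡ c
divBy-exact zero {c} (divides q eq) = trans (ℤ.*-zeroˡ c) (sym (trans eq (ℤ.*-zeroʳ q)))
divBy-exact (suc d) {+ n} h = trans (sym (ℤ.pos-* (suc d) (n ℕ./ suc d))) (cong +_ (ℕ.m*[n/m]≡n (∣⇒∣ᵤ {i = + n} h)))
-- the case split mirrors the definition of _/ℕ_ on negative dividends
divBy-exact (suc d) { ℤ.-[1+ n ]} h with suc n ℕ.% suc d | ℕ.n∣m⇒m%n≡0 (suc n) (suc d) (∣⇒∣ᵤ h)
... | zero | _ = begin
  + suc d * - + (suc n ℕ./ suc d)     ≡⟨ ℤ.neg-distribʳ-* (+ suc d) (+ (suc n ℕ./ suc d)) ⟨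
  - (+ suc d * + (suc n ℕ./ suc d))   ≡⟨ cong -_ (ℤ.pos-* (suc d) (suc n ℕ./ suc d)) ⟨
  - + (suc d ℕ.* (suc n ℕ./ suc d))   ≡⟨ cong (λ z → - + z) (ℕ.m*[n/m]≡n (∣⇒∣ᵤ h)) ⟩
  ℤ.-[1+ n ]                          ∎
  where open ≡-Reasoning

^-suc-pred : ∀ {p} .{{_ : NonZero p}} z → z ^ᶻ p ≡ z * z ^ᶻ (p ℕ.∸ 1)
^-suc-pred {suc _} z = refl

^-swap : ∀ z a b → (z ^ᶻ a) ^ᶻ b ≡ (z ^ᶻ b) ^ᶻ a
^-swap z a b = trans (ℤ.^-*-assoc z a b) (trans (cong (z ^ᶻ_) (ℕ.*-comm a b)) (sym (ℤ.^-*-assoc z b a)))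

pos-^-+ : ∀ p i j → + (p ^ (i ℕ.+ j)) ≡ + (p ^ i) * + (p ^ j)
pos-^-+ p i j = trans (cong +_ (ℕ.^-distribˡ-+-* p i j)) (ℤ.pos-* (p ^ i) (p ^ j))

pow-∣-pow : ∀ p {i j} → i ≤ j → + (p ^ i) ∣ + (p ^ j)
pow-∣-pow p {i} i≤j with ℕ.m≤n⇒∃[o]m+o≡n i≤j
... | o , refl = divides (+ (p ^ o)) (trans (pos-^-+ p i o) (ℤ.*-comm (+ (p ^ i)) (+ (p ^ o))))

^-split : ∀ z {i j} → j ≤ i → z ^ᶻ i ≡ z ^ᶻ j * z ^ᶻ (i ℕ.∸ j)
^-split z {i} {j} j≤i = trans (cong (z ^ᶻ_) (sym (ℕ.m+[n∸m]≡n j≤i))) (ℤ.^-distribˡ-+-* z j (i ℕ.∸ j))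

euclidsLemmaℤ : ∀ {p a} z → Prime p → + p ∣ + a * z → ¬ p ℕ.∣ a → + p ∣ z
euclidsLemmaℤ {p} {a} z pr p∣az p∤a with euclidsLemma a ℤ.∣ z ∣ pr (subst (p ℕ.∣_) (ℤ.abs-* (+ a) z) (∣⇒∣ᵤ p∣az))
... | inj₁ p∣a = ⊥-elim (p∤a p∣a)
... | inj₂ p∣z = ∣ᵤ⇒∣ p∣z

padic-coherent : ∀ {p} z → IsPadic p z → ∀ m j → z (m ℕ.+ j) ≡ z m [mod p ^ m ]
padic-coherent {p} z z-padic m zero    rewrite ℕ.+-identityʳ m = ≡-mod-refl
padic-coherent {p} z z-padic m (suc j) rewrite ℕ.+-suc m j =
  ≡-mod-trans (mod-weaken (∣⇒∣ᵤ (pow-∣-pow p (ℕ.m≤m+n m j))) (≋⇒≡-mod (z-padic (m ℕ.+ j))))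
              (padic-coherent z z-padic m j)

-- The binomial theorem at a prime

prime∤! : ∀ {p m} → Prime p → m < p → ¬ p ℕ.∣ m ℕ.!
prime∤! {p} {zero}  pr _   p∣1 = ¬prime[1] (subst Prime (ℕ.∣1⇒≡1 p∣1) pr)
prime∤! {p} {suc m} pr m<p p∣m! with euclidsLemma (suc m) (m ℕ.!) pr p∣m!
... | inj₁ p∣m = ℕ.<⇒≱ m<p (ℕ.∣⇒≤ p∣m)
... | inj₂ p∣m! = prime∤! pr (ℕ.<-trans (ℕ.n<1+n m) m<p) p∣m!

prime∣C : ∀ {p k} → Prime p → 0 < k → k < p → p ℕ.∣ p C k
prime∣C {p@(suc p-1)} {k} pr 0<k k<p with euclidsLemma (p C k) (k ℕ.! ℕ.* (p ℕ.∸ k) ℕ.!) pr p∣C*k![p-k]!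
  where
  instance _ = ℕ._!*_!≢0 k (p ℕ.∸ k)
  d = k ℕ.! ℕ.* (p ℕ.∸ k) ℕ.!
  C*k![p-k]!≡p! : (p C k) ℕ.* d ≡ p ℕ.!
  C*k![p-k]!≡p! = trans (cong (ℕ._* d) (nCk≡n!/k![n-k]! (ℕ.<⇒≤ k<p))) (ℕ.m/n*n≡m (k![n∸k]!∣n! (ℕ.<⇒≤ k<p)))
  p∣C*k![p-k]! : p ℕ.∣ (p C k) ℕ.* d
  p∣C*k![p-k]! = subst (p ℕ.∣_) (sym C*k![p-k]!≡p!) (ℕ.m∣m*n (p-1 ℕ.!))
... | inj₁ p∣C = p∣C
... | inj₂ p∣k![p-k]! with euclidsLemma (k ℕ.!) ((p ℕ.∸ k) ℕ.!) pr p∣k![p-k]!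
...   | inj₁ p∣k! = ⊥-elim (prime∤! pr k<p p∣k!)
...   | inj₂ p∣[p-k]! = ⊥-elim (prime∤! pr (ℕ.∸-monoʳ-< 0<k (ℕ.<⇒≤ k<p)) p∣[p-k]!)

^ˢ≡^ : ∀ z n → z ^ˢ n ≡ z ^ᶻ n
^ˢ≡^ z zero    = refl
^ˢ≡^ z (suc n) = cong (z *_) (^ˢ≡^ z n)

×ˢ≡* : ∀ n z → n ×ˢ z ≡ + n * z
×ˢ≡* zero    z = sym (ℤ.*-zeroˡ z)
×ˢ≡* (suc n) z = trans (cong (λ w → z + w) (×ˢ≡* n z)) (sym (ℤ.suc-* (+ n) z))

binomial-prime : ∀ {p} → Prime p → ∀ v h →
  ∃[ e ] (v + h) ^ᶻ p ≡ v ^ᶻ p + + p * (v ^ᶻ (p ℕ.∸ 1) * h + h * h * e) + h ^ᶻ p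
binomial-prime {suc (suc n)} pr v h = sum f , (begin
    (v + h) ^ᶻ p
      ≡⟨ trans (cong (_^ᶻ p) (ℤ.+-comm v h)) (sym (^ˢ≡^ (h + v) p)) ⟩
    (h + v) ^ˢ p
      ≡⟨ Binomial.theorem p h v ⟩
    term zero + (term (suc zero) + ∑[ j < suc n ] term (suc (suc j)))
      ≡⟨ cong (λ s → term zero + (term (suc zero) + s)) (sum-init-last (λ j → term (suc (suc j)))) ⟩
    term zero + (term (suc zero) + (∑[ j < n ] term (suc (suc (inject₁ j))) + term (suc (suc (fromℕ n)))))
      ≡⟨ cong₂ _+_ term-first (cong₂ _+_ term-second (cong₂ _+_ middle term-last)) ⟩
    v ^ᶻ p + (+ p * (v ^ᶻ suc n * h) + (+ p * (h * h * sum f) + h ^ᶻ p))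
      ≡⟨ regroup (+ p) (v ^ᶻ p) (v ^ᶻ suc n * h) (h * h * sum f) (h ^ᶻ p) ⟩
    v ^ᶻ p + + p * (v ^ᶻ suc n * h + h * h * sum f) + h ^ᶻ p ∎)
  where
  open ≡-Reasoning
  p = suc (suc n)
  term : Fin (suc p) → ℤ
  term = Binomial.binomialTerm h v p

  term-first : term zero ≡ v ^ᶻ p
  term-first = trans (×ˢ≡* (p C 0) _) (trans (ℤ.*-identityˡ _) (trans (ℤ.*-identityˡ _) (^ˢ≡^ v p)))

  term-second : term (suc zero) ≡ + p * (v ^ᶻ suc n * h)
  term-second = trans (×ˢ≡* (p C 1) _)
    (trans (cong₂ (λ c w → + c * (h * 1ℤ * w)) (nC1≡n p) (^ˢ≡^ v (suc n))) (reorder (+ p) h (v ^ᶻ suc n)))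
    where
    reorder : ∀ P h w → P * (h * 1ℤ * w) ≡ P * (w * h)
    reorder = solve-∀

  module _ (j : Fin n) where
    i = toℕ (inject₁ j)
    k = suc (suc i)

    p∣C : p ℕ.∣ p C k
    p∣C = prime∣C pr (s≤s z≤n) (s≤s (s≤s (subst (ℕ._< n) (sym (Fin.toℕ-inject₁ j)) (Fin.toℕ<n j))))

    f : ℤ
    f = + ℕ.quotient p∣C * (h ^ᶻ i * v ^ᶻ (p ℕ.∸ k))

    term-middle : term (suc (suc (inject₁ j))) ≡ + p * (h * h * f)
    term-middle = begin
      term (suc (suc (inject₁ j)))
        ≡⟨ ×ˢ≡* (p C k) _ ⟩
      + (p C k) * (h * (h * h ^ˢ i) * v ^ˢ (p ℕ.∸ k))
        ≡⟨ cong₂ (λ c w → + c * w) (ℕ.m∣n⇒n≡quotient*m p∣C) (cong₂ (λ a b → h * (h * a) * b) (^ˢ≡^ h i) (^ˢ≡^ v (p ℕ.∸ k))) ⟩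
      + (ℕ.quotient p∣C ℕ.* p) * (h * (h * h ^ᶻ i) * v ^ᶻ (p ℕ.∸ k))
        ≡⟨ trans (cong (_* (h * (h * h ^ᶻ i) * v ^ᶻ (p ℕ.∸ k))) (ℤ.pos-* (ℕ.quotient p∣C) p))
                 (reorder (+ ℕ.quotient p∣C) (+ p) h (h ^ᶻ i) (v ^ᶻ (p ℕ.∸ k))) ⟩
      + p * (h * h * f) ∎
      where
      reorder : ∀ c P h H V → c * P * (h * (h * H) * V) ≡ P * (h * h * (c * (H * V)))
      reorder = solve-∀

  middle : ∑[ j < n ] term (suc (suc (inject₁ j))) ≡ + p * (h * h * sum f)
  middle = trans (sum-cong-≗ term-middle)
    (trans (sym (*-distribˡ-sum (+ p) (λ j → h * h * f j))) (cong (+ p *_) (sym (*-distribˡ-sum (h * h) f))))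

  top-term : ∀ {k} → k ≡ p → (p C k) ×ˢ (h ^ˢ k * v ^ˢ (p ℕ.∸ k)) ≡ h ^ᶻ p
  top-term refl = begin
    (p C p) ×ˢ (h ^ˢ p * v ^ˢ (n ℕ.∸ n))   ≡⟨ ×ˢ≡* (p C p) _ ⟩
    + (p C p) * (h ^ˢ p * v ^ˢ (n ℕ.∸ n))  ≡⟨ cong₂ (λ c e → + c * (h ^ˢ p * v ^ˢ e)) (nCn≡1 p) (ℕ.n∸n≡0 n) ⟩
    + 1 * (h ^ˢ p * 1ℤ)                    ≡⟨ trans (ℤ.*-identityˡ _) (trans (ℤ.*-identityʳ _) (^ˢ≡^ h p)) ⟩
    h ^ᶻ p                                 ∎

  term-last : term (suc (suc (fromℕ n))) ≡ h ^ᶻ p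
  term-last = top-term (cong (λ i → suc (suc i)) (Fin.toℕ-fromℕ n))

  regroup : ∀ P a b c d → a + (P * b + (P * c + d)) ≡ a + P * (b + c) + d
  regroup = solve-∀

-- Powers of p-adic units

module _ {p : ℕ} (p-prime : Prime p) where

  private instance
    p-nonZero : NonZero p
    p-nonZero = prime⇒nonZero p-prime

  2≤p : 2 ≤ p
  2≤p = ℕ.nonTrivial⇒n>1 p {{prime⇒nonTrivial p-prime}}

  fermat : ∀ a → (+ a) ^ᶻ p ≡ + a [mod p ]
  fermat zero    = ≡⇒≡-mod (trans (^-suc-pred (+ 0)) (ℤ.*-zeroˡ ((+ 0) ^ᶻ (p ℕ.∸ 1))))
  fermat (suc a) with binomial-prime p-prime 1ℤ (+ a)
  ... | e , expand = begin
    (+ suc a) ^ᶻ p                                       ≡⟨ expand ⟩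
    1ℤ ^ᶻ p + + p * X + (+ a) ^ᶻ p                       ≡⟨ regroup (1ℤ ^ᶻ p) (+ p) X ((+ a) ^ᶻ p) ⟩
    (1ℤ ^ᶻ p + (+ a) ^ᶻ p) + + p * X                     ≈⟨ multiple-mod (1ℤ ^ᶻ p + (+ a) ^ᶻ p) X ⟩
    1ℤ ^ᶻ p + (+ a) ^ᶻ p                                 ≈⟨ +-cong-mod (≡⇒≡-mod (ℤ.^-zeroˡ p)) (fermat a) ⟩
    + suc a                                              ∎
    where
    X = 1ℤ ^ᶻ (p ℕ.∸ 1) * + a + + a * + a * e
    regroup : ∀ A P X C → A + P * X + C ≡ (A + C) + P * X
    regroup = solve-∀
    open ModReasoning p

  fermat-unit : ∀ {a} → ¬ p ℕ.∣ a → (+ a) ^ᶻ (p ℕ.∸ 1) ≡ 1ℤ [mod p ]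
  fermat-unit {a} p∤a = mod-intro (euclidsLemmaℤ _ p-prime (subst (+ p ∣_) factor (mod-divides (fermat a))) p∤a)
    where
    factor : (+ a) ^ᶻ p - + a ≡ + a * ((+ a) ^ᶻ (p ℕ.∸ 1) - 1ℤ)
    factor = trans (cong (_- + a) (^-suc-pred (+ a))) (factor′ (+ a) ((+ a) ^ᶻ (p ℕ.∸ 1)))
      where
      factor′ : ∀ a A → a * A - a ≡ a * (A - 1ℤ)
      factor′ = solve-∀

  ^p-lift : ∀ {m u v} → 1 ≤ m → u ≡ v [mod p ^ m ] → u ^ᶻ p ≡ v ^ᶻ p [mod p ^ suc m ]
  ^p-lift {m} {u} {v} 1≤m u≡v with ≡-mod⇒multiple u≡v
  ... | c , refl with binomial-prime p-prime v (+ (p ^ m) * c)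
  ... | e , expand = mod-intro (subst (+ (p ^ suc m) ∣_) (sym difference)
    (∣m∣n⇒∣m+n (∣m⇒∣m*n X ∣-refl) (∣m⇒∣m*n Y (pow-∣-pow p (ℕ.+-monoˡ-≤ m 1≤m)))))
    where
    open ≡-Reasoning
    P = + (p ^ m)
    h = P * c
    H = h ^ᶻ (p ℕ.∸ 2)
    X = v ^ᶻ (p ℕ.∸ 1) * c + c * c * P * e
    Y = c * c * H
    regroup : ∀ vp pp P V c e H →
      vp + pp * (V * (P * c) + P * c * (P * c) * e) + P * c * (P * c * 1ℤ) * H - vp
        ≡ (pp * P) * (V * c + c * c * P * e) + (P * P) * (c * c * H)
    regroup = solve-∀
    difference : (v + h) ^ᶻ p - v ^ᶻ p ≡ + (p ^ suc m) * X + + (p ^ (m ℕ.+ m)) * Y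
    difference = begin
      (v + h) ^ᶻ p - v ^ᶻ p
        ≡⟨ cong (_- v ^ᶻ p) (trans expand
             (cong (λ w → v ^ᶻ p + + p * (v ^ᶻ (p ℕ.∸ 1) * h + h * h * e) + w) (^-split h 2≤p))) ⟩
      v ^ᶻ p + + p * (v ^ᶻ (p ℕ.∸ 1) * h + h * h * e) + h * (h * 1ℤ) * H - v ^ᶻ p
        ≡⟨ regroup (v ^ᶻ p) (+ p) P (v ^ᶻ (p ℕ.∸ 1)) c e H ⟩
      (+ p * P) * X + (P * P) * Y
        ≡⟨ cong₂ (λ a b → a * X + b * Y) (sym (ℤ.pos-* p (p ^ m))) (sym (pos-^-+ p m m)) ⟩
      + (p ^ suc m) * X + + (p ^ (m ℕ.+ m)) * Y ∎

  -- Beyond the linear term, the binomial expansion consists of multiples of p·h² and of h³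
  -- (as p ≥ 3), both divisible by p^(m+2) when h = p^m·t and m ≥ 1.
  ^p-perturb : 2 < p → ∀ {m s} t → 1 ≤ m → s ^ᶻ (p ℕ.∸ 1) ≡ 1ℤ [mod p ] →
    (s + + (p ^ m) * t) ^ᶻ p ≡ s ^ᶻ p + + (p ^ suc m) * t [mod p ^ suc (suc m) ]
  ^p-perturb 2<p {m} {s} t 1≤m (mod-intro (divides d S-1≡dp)) with binomial-prime p-prime s (+ (p ^ m) * t)
  ... | e , expand = mod-intro (subst (+ (p ^ suc (suc m)) ∣_) (sym difference)
    (∣m∣n⇒∣m+n (∣m∣n⇒∣m+n (∣m⇒∣m*n (t * d) ∣-refl)
                             (∣m⇒∣m*n (t * t * e) (pow-∣-pow p (s≤s 1+m≤m+m))))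
                (∣m⇒∣m*n (t * t * t * H) (pow-∣-pow p (ℕ.≤-trans (s≤s 1+m≤m+m) (ℕ.+-monoˡ-≤ (m ℕ.+ m) 1≤m))))))
    where
    open ≡-Reasoning
    1+m≤m+m = ℕ.+-monoˡ-≤ m 1≤m
    P = + (p ^ m)
    S = s ^ᶻ (p ℕ.∸ 1)
    h = P * t
    H = h ^ᶻ (p ℕ.∸ 3)
    regroup : ∀ sp pp P S t e H →
      sp + pp * (S * (P * t) + P * t * (P * t) * e) + P * t * (P * t * (P * t * 1ℤ)) * H - (sp + pp * P * t)
        ≡ (pp * P) * (t * (S - 1ℤ)) + (pp * (P * P)) * (t * t * e) + (P * (P * P)) * (t * t * t * H)
    regroup = solve-∀
    reorder : ∀ pp P t d → (pp * P) * (t * (d * pp)) ≡ (pp * (pp * P)) * (t * d)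
    reorder = solve-∀
    difference : (s + h) ^ᶻ p - (s ^ᶻ p + + (p ^ suc m) * t)
      ≡ + (p ^ suc (suc m)) * (t * d) + + (p ^ suc (m ℕ.+ m)) * (t * t * e) + + (p ^ (m ℕ.+ (m ℕ.+ m))) * (t * t * t * H)
    difference = begin
      (s + h) ^ᶻ p - (s ^ᶻ p + + (p ^ suc m) * t)
        ≡⟨ cong₂ (λ a b → a - (s ^ᶻ p + b * t))
             (trans expand (cong (λ w → s ^ᶻ p + + p * (S * h + h * h * e) + w) (^-split h 2<p)))
             (ℤ.pos-* p (p ^ m)) ⟩
      s ^ᶻ p + + p * (S * h + h * h * e) + h * (h * (h * 1ℤ)) * H - (s ^ᶻ p + + p * P * t)
        ≡⟨ regroup (s ^ᶻ p) (+ p) P S t e H ⟩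
      (+ p * P) * (t * (S - 1ℤ)) + (+ p * (P * P)) * (t * t * e) + (P * (P * P)) * (t * t * t * H)
        ≡⟨ cong (λ w → w + (+ p * (P * P)) * (t * t * e) + (P * (P * P)) * (t * t * t * H))
             (trans (cong (λ w → (+ p * P) * (t * w)) S-1≡dp) (reorder (+ p) P t d)) ⟩
      (+ p * (+ p * P)) * (t * d) + (+ p * (P * P)) * (t * t * e) + (P * (P * P)) * (t * t * t * H)
        ≡⟨ cong₂ _+_ (cong₂ (λ a b → a * (t * d) + b * (t * t * e)) p^[2+m] p^[1+2m]) (cong (_* (t * t * t * H)) p^[3m]) ⟩
      + (p ^ suc (suc m)) * (t * d) + + (p ^ suc (m ℕ.+ m)) * (t * t * e) + + (p ^ (m ℕ.+ (m ℕ.+ m))) * (t * t * t * H) ∎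
      where
      p^[2+m] : + p * (+ p * P) ≡ + (p ^ suc (suc m))
      p^[2+m] = sym (trans (ℤ.pos-* p (p ^ suc m)) (cong (+ p *_) (ℤ.pos-* p (p ^ m))))
      p^[1+2m] : + p * (P * P) ≡ + (p ^ suc (m ℕ.+ m))
      p^[1+2m] = sym (trans (ℤ.pos-* p (p ^ (m ℕ.+ m))) (cong (+ p *_) (pos-^-+ p m m)))
      p^[3m] : P * (P * P) ≡ + (p ^ (m ℕ.+ (m ℕ.+ m)))
      p^[3m] = sym (trans (pos-^-+ p m (m ℕ.+ m)) (cong (P *_) (pos-^-+ p m m)))

  ^-unit : ∀ {s} j → s ^ᶻ (p ℕ.∸ 1) ≡ 1ℤ [mod p ] → (s ^ᶻ j) ^ᶻ (p ℕ.∸ 1) ≡ 1ℤ [mod p ]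
  ^-unit {s} j unit = begin
    (s ^ᶻ j) ^ᶻ (p ℕ.∸ 1)   ≡⟨ ^-swap s j (p ℕ.∸ 1) ⟩
    (s ^ᶻ (p ℕ.∸ 1)) ^ᶻ j   ≈⟨ ^-cong-mod j unit ⟩
    1ℤ ^ᶻ j                 ≡⟨ ℤ.^-zeroˡ j ⟩
    1ℤ                      ∎
    where open ModReasoning p

  ^-p^suc : ∀ z k → z ^ᶻ (p ^ suc k) ≡ (z ^ᶻ (p ^ k)) ^ᶻ p
  ^-p^suc z k = trans (cong (z ^ᶻ_) (ℕ.*-comm p (p ^ k))) (sym (ℤ.^-*-assoc z (p ^ k) p))

  ^p^k-perturb : 2 < p → ∀ k {m s} t → 1 ≤ m → s ^ᶻ (p ℕ.∸ 1) ≡ 1ℤ [mod p ] →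
    (s + + (p ^ m) * t) ^ᶻ (p ^ k) ≡ s ^ᶻ (p ^ k) + + (p ^ (m ℕ.+ k)) * t [mod p ^ suc (m ℕ.+ k) ]
  ^p^k-perturb 2<p k {m} {s} t 1≤m unit =
    subst (λ i → (s + + (p ^ m) * t) ^ᶻ (p ^ k) ≡ s ^ᶻ (p ^ k) + + (p ^ i) * t [mod p ^ suc i ])
          (ℕ.+-comm k m) (go k t 1≤m unit)
    where
    go : ∀ k {m s} t → 1 ≤ m → s ^ᶻ (p ℕ.∸ 1) ≡ 1ℤ [mod p ] →
      (s + + (p ^ m) * t) ^ᶻ (p ^ k) ≡ s ^ᶻ (p ^ k) + + (p ^ (k ℕ.+ m)) * t [mod p ^ suc (k ℕ.+ m) ]
    go zero {m} {s} t 1≤m unit =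
      ≡⇒≡-mod (trans (ℤ.^-identityʳ _) (cong (_+ + (p ^ m) * t) (sym (ℤ.^-identityʳ s))))
    go (suc k) {m} {s} t 1≤m unit = begin
      (s + + (p ^ m) * t) ^ᶻ (p ^ suc k)                    ≡⟨ ^-p^suc _ k ⟩
      ((s + + (p ^ m) * t) ^ᶻ (p ^ k)) ^ᶻ p                 ≡⟨ cong (_^ᶻ p) (trans (proj₂ previous) regroup) ⟩
      (S + + (p ^ (k ℕ.+ m)) * t′) ^ᶻ p
        ≈⟨ ^p-perturb 2<p t′ (ℕ.≤-trans 1≤m (ℕ.m≤n+m m k)) (^-unit (p ^ k) unit) ⟩
      S ^ᶻ p + + (p ^ suc (k ℕ.+ m)) * t′
        ≡⟨ trans (cong₂ _+_ (sym (^-p^suc s k)) (expand-t′ (p ^ suc (k ℕ.+ m)))) (sym (ℤ.+-assoc (s ^ᶻ (p ^ suc k)) _ _)) ⟩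
      s ^ᶻ (p ^ suc k) + + (p ^ suc (k ℕ.+ m)) * t + + (p ^ suc (suc (k ℕ.+ m))) * c
        ≈⟨ multiple-mod (s ^ᶻ (p ^ suc k) + + (p ^ suc (k ℕ.+ m)) * t) c ⟩
      s ^ᶻ (p ^ suc k) + + (p ^ suc (k ℕ.+ m)) * t          ∎
      where
      open ModReasoning (p ^ suc (suc (k ℕ.+ m)))
      S = s ^ᶻ (p ^ k)
      previous = ≡-mod⇒multiple (go k t 1≤m unit)
      c = proj₁ previous
      t′ = t + + p * c
      expand-t′ : ∀ q → + q * t′ ≡ + q * t + + (p ℕ.* q) * c
      expand-t′ q = trans (distrib (+ q) t (+ p) c) (cong (λ w → + q * t + w * c) (sym (ℤ.pos-* p q)))
        where
        distrib : ∀ q t p c → q * (t + p * c) ≡ q * t + p * q * c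
        distrib = solve-∀
      regroup : S + + (p ^ (k ℕ.+ m)) * t + + (p ^ suc (k ℕ.+ m)) * c ≡ S + + (p ^ (k ℕ.+ m)) * t′
      regroup = trans (ℤ.+-assoc S _ _) (cong (λ w → S + w) (sym (expand-t′ (p ^ (k ℕ.+ m)))))

  mod-p⇒mod-p^1 : ∀ {a b} → a ≡ b [mod p ] → a ≡ b [mod p ^ 1 ]
  mod-p⇒mod-p^1 = mod-weaken (ℕ.∣-reflexive (ℕ.*-identityʳ p))

  ^p^j-lift : ∀ j {u v} → u ≡ v [mod p ] → u ^ᶻ (p ^ j) ≡ v ^ᶻ (p ^ j) [mod p ^ suc j ]
  ^p^j-lift zero {u} {v} u≡v = begin
    u ^ᶻ 1  ≡⟨ ℤ.^-identityʳ u ⟩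
    u       ≈⟨ mod-p⇒mod-p^1 u≡v ⟩
    v       ≡⟨ ℤ.^-identityʳ v ⟨
    v ^ᶻ 1  ∎
    where open ModReasoning (p ^ 1)
  ^p^j-lift (suc j) {u} {v} u≡v = begin
    u ^ᶻ (p ^ suc j)       ≡⟨ ^-p^suc u j ⟩
    (u ^ᶻ (p ^ j)) ^ᶻ p    ≈⟨ ^p-lift {m = suc j} (s≤s z≤n) (^p^j-lift j u≡v) ⟩
    (v ^ᶻ (p ^ j)) ^ᶻ p    ≡⟨ ^-p^suc v j ⟨
    v ^ᶻ (p ^ suc j)       ∎
    where open ModReasoning (p ^ suc (suc j))

  teich-≡ : ∀ a j → (+ a) ^ᶻ (p ^ j) ≡ + a [mod p ]
  teich-≡ a zero    = ≡⇒≡-mod (ℤ.^-identityʳ (+ a))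
  teich-≡ a (suc j) = begin
    (+ a) ^ᶻ (p ^ suc j)      ≡⟨ ^-p^suc (+ a) j ⟩
    ((+ a) ^ᶻ (p ^ j)) ^ᶻ p   ≈⟨ ^-cong-mod p (teich-≡ a j) ⟩
    (+ a) ^ᶻ p                ≈⟨ fermat a ⟩
    + a                       ∎
    where open ModReasoning p

  teich-step : ∀ a j → (+ a) ^ᶻ (p ^ suc j) ≡ (+ a) ^ᶻ (p ^ j) [mod p ^ suc j ]
  teich-step a j = begin
    (+ a) ^ᶻ (p ^ suc j)      ≡⟨ ℤ.^-*-assoc (+ a) p (p ^ j) ⟨
    ((+ a) ^ᶻ p) ^ᶻ (p ^ j)   ≈⟨ ^p^j-lift j (fermat a) ⟩
    (+ a) ^ᶻ (p ^ j)          ∎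
    where open ModReasoning (p ^ suc j)

  teich-unit : ∀ {a} → ¬ p ℕ.∣ a → ∀ j → ((+ a) ^ᶻ (p ^ j)) ^ᶻ (p ℕ.∸ 1) ≡ 1ℤ [mod p ^ suc j ]
  teich-unit {a} p∤a j = begin
    ((+ a) ^ᶻ (p ^ j)) ^ᶻ (p ℕ.∸ 1)   ≡⟨ ^-swap (+ a) (p ^ j) (p ℕ.∸ 1) ⟩
    ((+ a) ^ᶻ (p ℕ.∸ 1)) ^ᶻ (p ^ j)   ≈⟨ ^p^j-lift j (fermat-unit p∤a) ⟩
    1ℤ ^ᶻ (p ^ j)                     ≡⟨ ℤ.^-zeroˡ (p ^ j) ⟩
    1ℤ                                ∎
    where open ModReasoning (p ^ suc j)

  pow-cancel-mod : ∀ j {a b} → + (p ^ j) * a ≡ + (p ^ j) * b [mod p ^ suc j ] → a ≡ b [mod p ]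
  pow-cancel-mod j h = mod-cancel (p ^ j) {{ℕ.m^n≢0 p j}} (mod-weaken (ℕ.∣-reflexive (ℕ.*-comm (p ^ j) p)) h)

  q₁-exact : ∀ z n → z (suc n) ^ᶻ (p ℕ.∸ 1) ≡ 1ℤ [mod p ] → + p * q₁ p z n ≡ z (suc n) ^ᶻ (p ℕ.∸ 1) - 1ℤ
  q₁-exact z n unit = divBy-exact p (mod-divides unit)

  q₁-coherent : ∀ z → IsPadic p z → (∀ n → z (suc n) ^ᶻ (p ℕ.∸ 1) ≡ 1ℤ [mod p ]) →
    ∀ m j → q₁ p z (m ℕ.+ j) ≡ q₁ p z m [mod p ^ m ]
  q₁-coherent z z-padic unit m j = mod-cancel p (begin
    + p * q₁ p z (m ℕ.+ j)                ≡⟨ q₁-exact z (m ℕ.+ j) (unit (m ℕ.+ j)) ⟩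
    z (suc m ℕ.+ j) ^ᶻ (p ℕ.∸ 1) - 1ℤ     ≈⟨ +-congʳ-mod (- 1ℤ) (^-cong-mod (p ℕ.∸ 1) (padic-coherent z z-padic (suc m) j)) ⟩
    z (suc m) ^ᶻ (p ℕ.∸ 1) - 1ℤ           ≡⟨ q₁-exact z m (unit m) ⟨
    + p * q₁ p z m                        ∎)
    where open ModReasoning (p ^ suc m)

-- p^k-th roots by successive approximation

module Hensel {p : ℕ} (p-prime : Prime p) (2<p : 2 < p) (k : ℕ) {x : Seq} (x-padic : IsPadic p x)
         {a : ℕ} (p∤a : ¬ p ℕ.∣ a) (base : x (suc k) ≡ (+ a) ^ᶻ (p ^ k) [mod p ^ suc k ]) where

  record RootApprox (m : ℕ) : Set where
    field
      value : ℤ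
      value≡a : value ≡ + a [mod p ]
      value-root : value ^ᶻ (p ^ k) ≡ x (suc m ℕ.+ k) [mod p ^ suc (m ℕ.+ k) ]

  open RootApprox

  module _ {m} (s : RootApprox m) where

    defect : ∃[ t ] x (suc (suc m ℕ.+ k)) ≡ value s ^ᶻ (p ^ k) + + (p ^ suc (m ℕ.+ k)) * t
    defect = ≡-mod⇒multiple (≡-mod-trans (≋⇒≡-mod (x-padic (suc m ℕ.+ k))) (≡-mod-sym (value-root s)))

    refine : RootApprox (suc m)
    refine .value      = value s + + (p ^ suc m) * proj₁ defect
    refine .value≡a    = ≡-mod-trans (mod-weaken (ℕ.m∣m*n (p ^ m)) (multiple-mod (value s) (proj₁ defect))) (value≡a s)
    refine .value-root = begin
      (value s + + (p ^ suc m) * proj₁ defect) ^ᶻ (p ^ k)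
        ≈⟨ ^p^k-perturb p-prime 2<p k {m = suc m} (proj₁ defect) (s≤s z≤n)
             (≡-mod-trans (^-cong-mod (p ℕ.∸ 1) (value≡a s)) (fermat-unit p-prime p∤a)) ⟩
      value s ^ᶻ (p ^ k) + + (p ^ suc (m ℕ.+ k)) * proj₁ defect
        ≡⟨ proj₂ defect ⟨
      x (suc (suc m ℕ.+ k)) ∎
      where open ModReasoning (p ^ suc (suc m ℕ.+ k))

  root-approx : ∀ m → RootApprox m
  root-approx zero    = record { value = + a ; value≡a = ≡-mod-refl {a = + a} ; value-root = ≡-mod-sym base }
  root-approx (suc m) = refine (root-approx m)

  root : Seq
  root zero    = + a
  root (suc m) = value (root-approx m)

  root-padic : IsPadic p root
  root-padic zero    = ≡-mod⇒≋ (mod-1 {root 1} {root 0})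
  root-padic (suc m) = ≡-mod⇒≋ (multiple-mod (root (suc m)) (proj₁ (defect (root-approx m))))

  root≡a : ∀ m → root (suc m) ≡ + a [mod p ]
  root≡a m = value≡a (root-approx m)

  root-root : ∀ m → root (suc m) ^ᶻ (p ^ k) ≡ x (suc m ℕ.+ k) [mod p ^ suc (m ℕ.+ k) ]
  root-root m = value-root (root-approx m)

-- Witt vector digits

sumBelow-sparse : ∀ k f → (∀ i → 1 ≤ i → i ≤ k → f i ≡ 0ℤ) → sumBelow (suc k) f ≡ f 0
sumBelow-sparse zero    f vanish = ℤ.+-identityˡ (f 0)
sumBelow-sparse (suc k) f vanish =
  trans (cong₂ _+_ (sumBelow-sparse k f (λ i 1≤i i≤k → vanish i 1≤i (ℕ.m≤n⇒m≤1+n i≤k)))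
                   (vanish (suc k) (s≤s z≤n) ℕ.≤-refl))
        (ℤ.+-identityʳ (f 0))

module WittDigits {p : ℕ} (p-prime : Prime p) (k : ℕ) {x : Seq} (x-padic : IsPadic p x)
         {w : ℕ → Fin p} (x-witt : IsWitt p x w)
         (w₀≢0 : toℕ (w 0) ≢ 0) (vanish : ∀ i → 1 ≤ i → i ≤ k → toℕ (w i) ≡ 0) where

  private
    instance
      p-nonZero : NonZero p
      p-nonZero = prime⇒nonZero p-prime

    a b : ℕ
    a = toℕ (w 0)
    b = toℕ (w (suc k))

    A B : ℕ → ℤ
    A = teich p (w 0)
    B = teich p (w (suc k))

  p∤a : ¬ p ℕ.∣ a
  p∤a p∣a = ℕ.<⇒≱ (Fin.toℕ<n (w 0)) (ℕ.∣⇒≤ {{ℕ.≢-nonZero w₀≢0}} p∣a)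

  witt-sum : ∀ N → sumBelow (suc k) (λ i → + (p ^ i) * teich p (w i) N) ≡ A N
  witt-sum N = trans (sumBelow-sparse k _ vanishing) (ℤ.*-identityˡ (A N))
    where
    vanishing : ∀ i → 1 ≤ i → i ≤ k → + (p ^ i) * teich p (w i) N ≡ 0ℤ
    vanishing i 1≤i i≤k = begin
      + (p ^ i) * (+ toℕ (w i)) ^ᶻ (p ^ N)   ≡⟨ cong (λ c → + (p ^ i) * (+ c) ^ᶻ (p ^ N)) (vanish i 1≤i i≤k) ⟩
      + (p ^ i) * (+ 0) ^ᶻ (p ^ N)           ≡⟨ cong (+ (p ^ i) *_) (^-suc-pred {{ℕ.m^n≢0 p N}} (+ 0)) ⟩
      + (p ^ i) * (+ 0 * (+ 0) ^ᶻ (p ^ N ℕ.∸ 1))  ≡⟨ ℤ.*-zeroʳ (+ (p ^ i)) ⟩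
      0ℤ                                     ∎
      where open ≡-Reasoning

  x-leading : x (suc k) ≡ (+ a) ^ᶻ (p ^ k) [mod p ^ suc k ]
  x-leading = ≡-mod-trans (≋⇒≡-mod (x-witt (suc k))) (≡-mod-trans (≡⇒≡-mod (witt-sum (suc k))) (teich-step p-prime a k))

  x-next : x (suc (suc k)) ≡ A (suc (suc k)) + + (p ^ suc k) * B (suc (suc k)) [mod p ^ suc (suc k) ]
  x-next = ≡-mod-trans (≋⇒≡-mod (x-witt (suc (suc k))))
                       (≡⇒≡-mod (cong (_+ + (p ^ suc k) * B (suc (suc k))) (witt-sum (suc (suc k)))))

  x≡a : ∀ n → x (suc n) ≡ + a [mod p ]
  x≡a n = begin
    x (suc n)          ≈⟨ mod-weaken (ℕ.m∣m*n 1) (padic-coherent x x-padic 1 n) ⟩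
    x 1                ≈⟨ mod-weaken (ℕ.m∣m*n 1) (padic-coherent x x-padic 1 k) ⟨
    x (suc k)          ≈⟨ mod-weaken (ℕ.m∣m*n (p ^ k)) x-leading ⟩
    (+ a) ^ᶻ (p ^ k)   ≈⟨ teich-≡ p-prime a k ⟩
    + a                ∎
    where open ModReasoning p

  x-unit : ∀ n → x (suc n) ^ᶻ (p ℕ.∸ 1) ≡ 1ℤ [mod p ]
  x-unit n = ≡-mod-trans (^-cong-mod (p ℕ.∸ 1) (x≡a n)) (fermat-unit p-prime p∤a)

  p^k∣q₁ : ∀ n → q₁ p x (n ℕ.+ k) ≡ 0ℤ [mod p ^ k ]
  p^k∣q₁ n = mod-cancel p (begin
    + p * q₁ p x (n ℕ.+ k)                      ≡⟨ q₁-exact p-prime x (n ℕ.+ k) (x-unit (n ℕ.+ k)) ⟩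
    x (suc (n ℕ.+ k)) ^ᶻ (p ℕ.∸ 1) - 1ℤ         ≡⟨ cong (λ i → x (suc i) ^ᶻ (p ℕ.∸ 1) - 1ℤ) (ℕ.+-comm n k) ⟩
    x (suc k ℕ.+ n) ^ᶻ (p ℕ.∸ 1) - 1ℤ
      ≈⟨ +-congʳ-mod (- 1ℤ) (^-cong-mod (p ℕ.∸ 1) (≡-mod-trans (padic-coherent x x-padic (suc k) n) x-leading)) ⟩
    ((+ a) ^ᶻ (p ^ k)) ^ᶻ (p ℕ.∸ 1) - 1ℤ        ≈⟨ +-congʳ-mod (- 1ℤ) (teich-unit p-prime p∤a k) ⟩
    1ℤ - 1ℤ                                     ≡⟨ ℤ.*-zeroʳ (+ p) ⟨
    + p * 0ℤ                                    ∎)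
    where open ModReasoning (p ^ suc k)

  q₁/p^k : Seq
  q₁/p^k n = divBy (p ^ k) (q₁ p x (n ℕ.+ k))

  q₁/p^k-spec : ∀ n → + (p ^ k) * q₁/p^k n ≡ q₁ p x (n ℕ.+ k)
  q₁/p^k-spec n = divBy-exact (p ^ k) (≡0-mod⇒∣ (p^k∣q₁ n))

  q₁/p^k-padic : IsPadic p q₁/p^k
  q₁/p^k-padic n = ≡-mod⇒≋ (mod-cancel (p ^ k) {{ℕ.m^n≢0 p k}} (mod-weaken (ℕ.∣-reflexive p^k*p^n≡p^[n+k]) (begin
    + (p ^ k) * q₁/p^k (suc n)     ≡⟨ q₁/p^k-spec (suc n) ⟩
    q₁ p x (suc (n ℕ.+ k))         ≡⟨ cong (q₁ p x) (ℕ.+-comm 1 (n ℕ.+ k)) ⟩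
    q₁ p x (n ℕ.+ k ℕ.+ 1)         ≈⟨ q₁-coherent p-prime x x-padic x-unit (n ℕ.+ k) 1 ⟩
    q₁ p x (n ℕ.+ k)               ≡⟨ q₁/p^k-spec n ⟨
    + (p ^ k) * q₁/p^k n           ∎)))
    where
    open ModReasoning (p ^ (n ℕ.+ k))
    p^k*p^n≡p^[n+k] : p ^ k ℕ.* p ^ n ≡ p ^ (n ℕ.+ k)
    p^k*p^n≡p^[n+k] = trans (ℕ.*-comm (p ^ k) (p ^ n)) (sym (ℕ.^-distribˡ-+-* p n k))

  q₁/p^k-scaled : (const (+ (p ^ k)) ⊗ q₁/p^k) ≈[ p ] q₁ p x
  q₁/p^k-scaled n = ≡-mod⇒≋ (≡-mod-trans (≡⇒≡-mod (q₁/p^k-spec n)) (q₁-coherent p-prime x x-padic x-unit n k))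

  scaled-next-digit :
    + (p ^ suc k) * (x (suc (suc k)) * q₁/p^k 1) ≡ + (p ^ suc k) * (- B (suc (suc k))) [mod p ^ suc (suc k) ]
  scaled-next-digit = begin
    + (p ^ suc k) * (X * Y)              ≡⟨ trans (cong (_* (X * Y)) (ℤ.pos-* p (p ^ k))) (regroup₁ (+ p) (+ (p ^ k)) X Y) ⟩
    X * (+ p * (+ (p ^ k) * Y))          ≡⟨ cong (λ q → X * (+ p * q)) (q₁/p^k-spec 1) ⟩
    X * (+ p * q₁ p x (suc k))           ≡⟨ cong (X *_) (q₁-exact p-prime x (suc k) (x-unit (suc k))) ⟩
    X * (X ^ᶻ (p ℕ.∸ 1) - 1ℤ)            ≡⟨ trans (cong (_- X) (^-suc-pred X)) (regroup₂ X (X ^ᶻ (p ℕ.∸ 1))) ⟨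
    X ^ᶻ p - X                           ≈⟨ +-cong-mod (^p-lift p-prime {m = suc k} (s≤s z≤n) X≡A) (-‿cong-mod x-next) ⟩
    A N ^ᶻ p - (A N + + (p ^ suc k) * B N) ≈⟨ +-congʳ-mod (- (A N + + (p ^ suc k) * B N)) A-fixed ⟩
    A N - (A N + + (p ^ suc k) * B N)    ≡⟨ regroup₃ (A N) (+ (p ^ suc k)) (B N) ⟩
    + (p ^ suc k) * (- B N)              ∎
    where
    open ModReasoning (p ^ suc (suc k))
    N = suc (suc k)
    X = x N
    Y = q₁/p^k 1
    X≡A : X ≡ A N [mod p ^ suc k ]
    X≡A = ≡-mod-trans (mod-weaken (ℕ.n∣m*n p) x-next) (multiple-mod (A N) (B N))
    A-fixed : A N ^ᶻ p ≡ A N [mod p ^ N ]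
    A-fixed = ≡-mod-trans (≡⇒≡-mod (sym (^-p^suc p-prime (+ a) N))) (mod-weaken (ℕ.n∣m*n p) (teich-step p-prime a N))
    regroup₁ : ∀ P Q X Y → P * Q * (X * Y) ≡ X * (P * (Q * Y))
    regroup₁ = solve-∀
    regroup₂ : ∀ X X′ → X * X′ - X ≡ X * (X′ - 1ℤ)
    regroup₂ = solve-∀
    regroup₃ : ∀ A P B → A - (A + P * B) ≡ P * (- B)
    regroup₃ = solve-∀

  next-digit : + b ≡ - (x 1 * q₁/p^k 1) [mod p ]
  next-digit = begin
    + b                         ≈⟨ teich-≡ p-prime b (suc (suc k)) ⟨
    B (suc (suc k))             ≡⟨ ℤ.neg-involutive (B (suc (suc k))) ⟨
    - (- B (suc (suc k)))       ≈⟨ -‿cong-mod (pow-cancel-mod p-prime (suc k) scaled-next-digit) ⟨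
    - (x (suc (suc k)) * Y)     ≈⟨ -‿cong-mod (*-cong-mod (≡-mod-trans (x≡a (suc k)) (≡-mod-sym (x≡a 0)))
                                                          (≡-mod-refl {a = Y})) ⟩
    - (x 1 * Y)                 ∎
    where
    open ModReasoning p
    Y = q₁/p^k 1

  module _ (2<p : 2 < p) where

    open Hensel p-prime 2<p k {x} x-padic p∤a x-leading using (root; root-padic; root≡a; root-root)

    root-^p^k : (root ^ₚ (p ^ k)) ≈[ p ] x
    root-^p^k zero    = ≡-mod⇒≋ (mod-1 {root 0 ^ᶻ (p ^ k)} {x 0})
    root-^p^k (suc m) = ≡-mod⇒≋ (≡-mod-trans
      (mod-weaken (∣⇒∣ᵤ (pow-∣-pow p (s≤s (ℕ.m≤m+n m k)))) (root-root m))
      (padic-coherent x x-padic (suc m) k))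

    root₂-expansion : ∃[ d ] root 2 ≡ A 2 + + (p ^ 1) * d
    root₂-expansion = ≡-mod⇒multiple (mod-p⇒mod-p^1 p-prime (≡-mod-trans (root≡a 1) (≡-mod-sym (teich-≡ p-prime a 2))))

    private
      d : ℤ
      d = proj₁ root₂-expansion

    root₂-digit-scaled : + (p ^ suc k) * d ≡ + (p ^ suc k) * B (suc (suc k)) [mod p ^ suc (suc k) ]
    root₂-digit-scaled = +-cancelˡ-mod {c = A (suc (suc k))} (begin
      A (suc (suc k)) + + (p ^ suc k) * d     ≡⟨ cong (_+ + (p ^ suc k) * d) A₂^p^k ⟨
      A 2 ^ᶻ (p ^ k) + + (p ^ suc k) * d      ≈⟨ ^p^k-perturb p-prime 2<p k {m = 1} d (s≤s z≤n) A₂-unit ⟨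
      (A 2 + + (p ^ 1) * d) ^ᶻ (p ^ k)        ≡⟨ cong (_^ᶻ (p ^ k)) (proj₂ root₂-expansion) ⟨
      root 2 ^ᶻ (p ^ k)                       ≈⟨ root-root 1 ⟩
      x (suc (suc k))                         ≈⟨ x-next ⟩
      A (suc (suc k)) + + (p ^ suc k) * B (suc (suc k)) ∎)
      where
      open ModReasoning (p ^ suc (suc k))
      A₂-unit : A 2 ^ᶻ (p ℕ.∸ 1) ≡ 1ℤ [mod p ]
      A₂-unit = mod-weaken (ℕ.m∣m*n (p ^ 2)) (teich-unit p-prime p∤a 2)
      A₂^p^k : A 2 ^ᶻ (p ^ k) ≡ A (suc (suc k))
      A₂^p^k = trans (ℤ.^-*-assoc (+ a) (p ^ 2) (p ^ k)) (cong ((+ a) ^ᶻ_) (sym (ℕ.^-distribˡ-+-* p 2 k)))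

    root-digits : root 2 ≡ A 2 + + p * B 2 [mod p ^ 2 ]
    root-digits = begin
      root 2                      ≡⟨ proj₂ root₂-expansion ⟩
      A 2 + + (p ^ 1) * d         ≡⟨ cong (λ q → A 2 + + q * d) (ℕ.*-identityʳ p) ⟩
      A 2 + + p * d               ≈⟨ +-congˡ-mod (A 2) (mod-weaken (ℕ.∣-reflexive (cong (p ℕ.*_) (ℕ.*-identityʳ p)))
                                                                   (mod-scale p d≡B₂)) ⟩
      A 2 + + p * B 2             ∎
      where
      open ModReasoning (p ^ 2)
      d≡B₂ : d ≡ B 2 [mod p ]
      d≡B₂ = ≡-mod-trans (pow-cancel-mod p-prime (suc k) root₂-digit-scaled)
               (≡-mod-trans (teich-≡ p-prime b (suc (suc k))) (≡-mod-sym (teich-≡ p-prime b 2)))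

    root-q₁-scaled : + (p ^ suc k) * q₁/p^k 1 ≡ + (p ^ suc k) * q₁ p root 1 [mod p ^ suc (suc k) ]
    root-q₁-scaled = begin
      + (p ^ suc k) * q₁/p^k 1
        ≡⟨ trans (cong (_* q₁/p^k 1) (ℤ.pos-* p (p ^ k))) (ℤ.*-assoc (+ p) (+ (p ^ k)) (q₁/p^k 1)) ⟩
      + p * (+ (p ^ k) * q₁/p^k 1)                  ≡⟨ cong (+ p *_) (q₁/p^k-spec 1) ⟩
      + p * q₁ p x (suc k)                          ≡⟨ q₁-exact p-prime x (suc k) (x-unit (suc k)) ⟩
      x (suc (suc k)) ^ᶻ (p ℕ.∸ 1) - 1ℤ             ≈⟨ +-congʳ-mod (- 1ℤ) (^-cong-mod (p ℕ.∸ 1) (root-root 1)) ⟨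
      (root 2 ^ᶻ (p ^ k)) ^ᶻ (p ℕ.∸ 1) - 1ℤ          ≡⟨ cong (_- 1ℤ) (^-swap (root 2) (p ^ k) (p ℕ.∸ 1)) ⟩
      u ^ᶻ (p ^ k) - 1ℤ                             ≡⟨ cong (λ v → v ^ᶻ (p ^ k) - 1ℤ) u≡1+pt ⟩
      (1ℤ + + (p ^ 1) * t) ^ᶻ (p ^ k) - 1ℤ
        ≈⟨ +-congʳ-mod (- 1ℤ) (^p^k-perturb p-prime 2<p k {m = 1} t (s≤s z≤n) (≡⇒≡-mod (ℤ.^-zeroˡ (p ℕ.∸ 1)))) ⟩
      1ℤ ^ᶻ (p ^ k) + + (p ^ suc k) * t - 1ℤ         ≡⟨ cong (λ v → v + + (p ^ suc k) * t - 1ℤ) (ℤ.^-zeroˡ (p ^ k)) ⟩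
      1ℤ + + (p ^ suc k) * t - 1ℤ                   ≡⟨ cancel-1 (+ (p ^ suc k) * t) ⟩
      + (p ^ suc k) * t                             ∎
      where
      open ModReasoning (p ^ suc (suc k))
      u = root 2 ^ᶻ (p ℕ.∸ 1)
      t = q₁ p root 1
      cancel-1 : ∀ z → 1ℤ + z - 1ℤ ≡ z
      cancel-1 = solve-∀
      restore-1 : ∀ z → 1ℤ + (z - 1ℤ) ≡ z
      restore-1 = solve-∀
      u-unit : u ≡ 1ℤ [mod p ]
      u-unit = ≡-mod-trans (^-cong-mod (p ℕ.∸ 1) (root≡a 1)) (fermat-unit p-prime p∤a)
      u≡1+pt : u ≡ 1ℤ + + (p ^ 1) * t
      u≡1+pt = trans (sym (restore-1 u)) (cong (λ z → 1ℤ + z)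
        (trans (sym (q₁-exact p-prime root 1 u-unit)) (cong (λ q → + q * t) (sym (ℕ.*-identityʳ p)))))

    root-q₁ : q₁ p root 1 ≡ q₁/p^k 1 [mod p ]
    root-q₁ = ≡-mod-sym (pow-cancel-mod p-prime (suc k) root-q₁-scaled)

mainTheorem3 : (p k : ℕ) → Prime p → 2 < p →
    (x : Seq) → IsPadic p x → (w : ℕ → Fin p) → IsWitt p x w →
    toℕ (w 0) ≢ 0 → (∀ i → 1 ≤ i → i ≤ k → toℕ (w i) ≡ 0) →
    Σ Seq λ y → IsPadic p y
      × (const (+ (p ^ k)) ⊗ y) ≈[ p ] q₁ p x
      × (+ toℕ (w (suc k)) ≋ - ((x ⊗ y) 1) [mod p ])
      × (1 ≤ k → Σ Seq λ r → IsPadic p r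
          × (r ^ₚ (p ^ k)) ≈[ p ] x
          × (r 2 ≋ teich p (w 0) 2 + (+ p) * teich p (w (suc k)) 2 [mod p ^ 2 ])
          × (q₁ p r 1 ≋ y 1 [mod p ]))
mainTheorem3 p k p-prime 2<p x x-padic w x-witt w₀≢0 vanish =
    q₁/p^k , q₁/p^k-padic , q₁/p^k-scaled , ≡-mod⇒≋ next-digit
  -- the root exists for k = 0 as well
  , λ _ → root , root-padic , root-^p^k 2<p , ≡-mod⇒≋ (root-digits 2<p) , ≡-mod⇒≋ (root-q₁ 2<p)
  where
  open WittDigits p-prime k {x} x-padic {w} x-witt w₀≢0 vanish
  open Hensel p-prime 2<p k {x} x-padic p∤a x-leading using (root; root-padic)
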